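{- Let $G=(A\cup P,\mathcal{E})$ be an instance of the rank-maximal matching problem representing the true preferences, and let $a_1\in A$ be such that some rank-maximal matching of $G$ does not match $a_1$ to a rank one post, and such that $a_1$'s true preference list contains a non-$f$-post. Let $p_i$ be a highest ranked non-$f$-post in the true preference list of $a_1$. Let $H$ be obtained from $G$ by replacing the preference list of $a_1$ by a falsified full preference list in which $p_i$ is the unique rank one post and the remaining posts are placed arbitrarily at ranks greater than one (the preference lists of all other applicants unchanged). Then $H$ realizes strategy `best nonfirst': every rank-maximal matching of $H$ matches $a_1$ to $p_i$, and for every rank-maximal matching $M'$ of $G$ in which $a_1$ is matched to a post $q$ whose true rank is greater than one, the true rank of $p_i$ is at most the true rank of $q$.
   Context: An instance is a bipartite graph $G=(A\cup P,\mathcal{E})$ ($A$ = applicants, $P$ = posts) in which each edge $(a,p)$ has a positive integer rank describing $a$'s preference list (ties allowed; smaller rank = more preferred; "highest ranked" = smallest rank). A matching is a set of edges no two sharing an endpoint. The signature of a matching $M$ is $(x_1,\dots,x_r)$ ($r$ the largest rank) with $x_i$ the number of applicants matched in $M$ by a rank $i$ edge; a matching is rank-maximal if its signature is lexicographically largest among all matchings. A full preference list is one containing every post of $P$, without gaps in the ranks. $G_1$ denotes the subgraph of $G$ of rank one edges. For a bipartite graph $K$ with a maximum matching $M$, a vertex is even (resp. odd) if reachable from some $M$-unmatched vertex by an $M$-alternating path of even (resp. odd) length, and unreachable otherwise; these sets $E(K),O(K),U(K)$ do not depend on $M$. A post is an $f$-post (with respect to $a_1$) if it belongs to $O(K)\cup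 U(K)$, where $K$ is obtained from $G_1$ by deleting $a_1$; all other posts are non-$f$-posts. The strategy `best nonfirst' requires that $a_1$ is never matched to a post worse (in his true preferences) than the most preferred post among those of true rank greater than one that he can obtain in a rank-maximal matching when truthful. -}

module Defs where

import Level
open import Data.Nat using (ℕ; zero; suc; _≤_; _<_; _*_)
open import Data.Nat.Properties using () renaming (_≟_ to _≟ℕ_)
open import Data.Fin using (Fin)
open import Data.Fin.Properties using () renaming (_≟_ to _≟F_)
open import Data.Maybe using (Maybe; just; nothing)
open import Data.Maybe.Properties using (≡-dec)
open import Data.List using (List; length; filter; allFin)
open import Data.Sum using (_⊎_; inj₁; inj₂)
open import Data.Product using (Σ; ∃; ∃-syntax; _×_; _,_)
open import Data.Empty using (⊥)
open import Data.Bool using (Bool; true; false)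
open import Relation.Nullary using (¬_; Dec; yes; no; ¬?)
open import Relation.Unary using (Pred; Decidable)
open import Relation.Binary.PropositionalEquality using (_≡_; _≢_)

-- Instances.  Applicants are Fin n, posts are Fin m.
-- G a p = just r  means (a,p) is an edge of rank r;  nothing = no edge.

Instance : ℕ → ℕ → Set
Instance n m = Fin n → Fin m → Maybe ℕ

PositiveRanks : ∀ {n m} → Instance n m → Set
PositiveRanks {n} {m} G = ∀ (a : Fin n) (p : Fin m) (r : ℕ) → G a p ≡ just r → 1 ≤ r

Graph : ℕ → ℕ → Set₁
Graph n m = Fin n → Fin m → Set

edges : ∀ {n m} → Instance n m → Graph n m
edges G a p = ∃[ r ] (G a p ≡ just r)

Assignment : ℕ → ℕ → Set
Assignment n m = Fin n → Maybe (Fin m)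

IsMatching : ∀ {n m} → Graph n m → Assignment n m → Set
IsMatching {n} {m} E M =
  (∀ (a : Fin n) (p : Fin m) → M a ≡ just p → E a p) ×
  (∀ (a b : Fin n) (p : Fin m) → M a ≡ just p → M b ≡ just p → a ≡ b)

count : ∀ {n} {P : Pred (Fin n) Level.zero} → Decidable P → ℕ
count {n} P? = length (filter P? (allFin n))

matchRank : ∀ {n m} → Instance n m → Assignment n m → Fin n → Maybe ℕ
matchRank G M a with M a
... | nothing = nothing
... | just p  = G a p

-- signature: sig G M i = number of applicants matched by a rank i edge
-- (only i = 1..r can be nonzero, r the largest rank)
signature : ∀ {n m} → Instance n m → Assignment n m → ℕ → ℕ
signature G M i = count (λ a → ≡-dec _≟ℕ_ (matchRank G M a) (just i))

_<lex_ : (ℕ → ℕ) → (ℕ → ℕ) → Set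
f <lex g = ∃[ i ] (f i < g i × (∀ j → j < i → f j ≡ g j))

IsRankMaximal : ∀ {n m} → Instance n m → Assignment n m → Set
IsRankMaximal G M =
  IsMatching (edges G) M ×
  (∀ N → IsMatching (edges G) N → ¬ (signature G M <lex signature G N))

size : ∀ {n m} → Assignment n m → ℕ
size M = count (λ a → ¬? (≡-dec _≟F_ (M a) nothing))

IsMaximumMatching : ∀ {n m} → Graph n m → Assignment n m → Set
IsMaximumMatching E M =
  IsMatching E M × (∀ N → IsMatching E N → size N ≤ size M)

Vertex : ℕ → ℕ → Set
Vertex n m = Fin n ⊎ Fin m

Adj : ∀ {n m} → Graph n m → Vertex n m → Vertex n m → Set
Adj E (inj₁ a) (inj₂ p) = E a p
Adj E (inj₂ p) (inj₁ a) = E a p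
Adj E _ _ = ⊥

InM : ∀ {n m} → Assignment n m → Vertex n m → Vertex n m → Set
InM M (inj₁ a) (inj₂ p) = M a ≡ just p
InM M (inj₂ p) (inj₁ a) = M a ≡ just p
InM M _ _ = ⊥

Unmatched : ∀ {n m} → Assignment n m → Vertex n m → Set
Unmatched M (inj₁ a) = M a ≡ nothing
Unmatched {n} M (inj₂ p) = ∀ (a : Fin n) → M a ≢ just p

-- M-alternating walk from v to w of length k; the Bool says whether the
-- next edge must be a matching edge (true) or a non-matching edge (false)
data AltWalk {n m} (E : Graph n m) (M : Assignment n m) :
       Bool → Vertex n m → Vertex n m → ℕ → Set where
  stop  : ∀ {b v} → AltWalk E M b v v 0
  nonM  : ∀ {v u w k} → Adj E v u → ¬ InM M v u →
          AltWalk E M true u w k → AltWalk E M false v w (suc k)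
  viaM  : ∀ {v u w k} → Adj E v u → InM M v u →
          AltWalk E M false u w k → AltWalk E M true v w (suc k)

-- even / odd vertices of K w.r.t. a maximum matching M: reachable from an
-- M-unmatched vertex by an M-alternating path of even / odd length
-- (the first edge out of an unmatched vertex is necessarily non-matching)
IsEven : ∀ {n m} → Graph n m → Assignment n m → Vertex n m → Set
IsEven E M v = ∃[ u ] ∃[ k ] (Unmatched M u × AltWalk E M false u v (2 * k))

IsOdd : ∀ {n m} → Graph n m → Assignment n m → Vertex n m → Set
IsOdd E M v = ∃[ u ] ∃[ k ] (Unmatched M u × AltWalk E M false u v (suc (2 * k)))

IsUnreachable : ∀ {n m} → Graph n m → Assignment n m → Vertex n m → Set
IsUnreachable E M v = ¬ IsEven E M v × ¬ IsOdd E M v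

-- f-posts w.r.t. a1: K = G1 with a1 deleted (a1 kept as isolated vertex,
-- which does not affect the classification of posts)

G1minus : ∀ {n m} → Instance n m → Fin n → Graph n m
G1minus G a1 a p = (a ≢ a1) × (G a p ≡ just 1)

-- p ∈ O(K) ∪ U(K)  (computed w.r.t. a maximum matching of K; the sets
-- E,O,U do not depend on the choice)
IsFPostWrt : ∀ {n m} → Instance n m → Fin n → Assignment n m → Fin m → Set
IsFPostWrt G a1 M p =
  IsOdd (G1minus G a1) M (inj₂ p) ⊎ IsUnreachable (G1minus G a1) M (inj₂ p)

IsNonFPost : ∀ {n m} → Instance n m → Fin n → Fin m → Set
IsNonFPost G a1 p =
  ∃[ M ] (IsMaximumMatching (G1minus G a1) M × ¬ IsFPostWrt G a1 M p)

SameExcept : ∀ {n m} → Instance n m → Instance n m → Fin n → Set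
SameExcept {n} G H a1 = ∀ (a : Fin n) → a ≢ a1 → ∀ p → H a p ≡ G a p

FullListTopping : ∀ {n m} → Instance n m → Fin n → Fin m → Set
FullListTopping {n} {m} H a1 p =
  (∀ (q : Fin m) → ∃[ r ] (H a1 q ≡ just r)) ×
  (∀ (q : Fin m) (r : ℕ) → H a1 q ≡ just r →
     ∀ (s : ℕ) → 1 ≤ s → s ≤ r → ∃[ q' ] (H a1 q' ≡ just s)) ×
  (H a1 p ≡ just 1) ×
  (∀ (q : Fin m) (r : ℕ) → q ≢ p → H a1 q ≡ just r → 2 ≤ r)

module Submission where

-- Write K for the graph of rank one edges of G without a₁, and p for the
-- highest ranked non-f-post pᵢ of a₁.  Everything rests on two facts about
-- a maximum matching M of an arbitrary bipartite graph, proved by shifting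
-- M along an alternating chain of posts:
--   * an even post v can be freed: some matching covers every applicant
--     that M covers and leaves v free (`even-post-can-be-freed');
--   * a free post is never odd, so it is a non-f-post
--     (`free-post-not-odd', `free-post-not-f').
-- Both parts of the theorem compare numbers of rank one edges.
--   (1) If a rank-maximal matching M′ of H does not give p to a₁, its rank
--       one edges lie in K, so there are at most |M| of them; freeing p in a
--       maximum matching of K and adding (a₁ , p) gives |M| + 1 rank one
--       edges in H, a contradiction (`falsified-instance-forces-top').
--   (2) If a rank-maximal matching M′ of G gives a₁ a post q of rank > 1,
--       then M′ restricted to K is a maximum matching of K in which q is
--       free, so q is a non-f-post and the minimality of pᵢ's rank applies.

open import Defs
open import Data.Nat using (ℕ; zero; suc; _≤_; _<_; _+_; _*_; z≤n; s≤s)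
open import Data.Nat.Properties using (≰⇒>; <⇒≱; <⇒≤; m≤n⇒m≤1+n; +-identityʳ; module ≤-Reasoning) renaming (_≤?_ to _≤ℕ?_; _≟_ to _≟ℕ_)
open import Data.Fin using (Fin)
open import Data.Fin.Properties using () renaming (_≟_ to _≟F_)
open import Data.Maybe using (just; nothing)
open import Data.Maybe.Properties using (≡-dec; just-injective)
open import Data.List using (_∷_; length; filter; allFin)
open import Data.List.Properties using (filter-none)
open import Data.List.Relation.Unary.All using (universal)
open import Data.List.Relation.Unary.Any using (here; there)
open import Data.List.Membership.Propositional using (_∈_)
open import Data.List.Membership.Propositional.Properties using (∈-allFin)
open import Data.List.Relation.Binary.Sublist.Propositional using (⊆-refl)
open import Data.List.Relation.Binary.Sublist.Heterogeneous.Properties using (length-mono-≤; ⊆-filter-Sublist)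
open import Data.Sum using (_⊎_; inj₁; inj₂)
open import Data.Product using (∃-syntax; _×_; _,_; proj₁; proj₂)
open import Data.Empty using (⊥-elim)
open import Data.Bool using (Bool; true; false; not; _xor_)
open import Data.Bool.Properties using (xor-same; not-distribˡ-xor; not-distribʳ-xor)
open import Relation.Nullary using (¬_; Dec; yes; no)
open import Relation.Nullary.Decidable using (decidable-stable)
open import Relation.Unary using (Pred; Decidable)
open import Relation.Binary.PropositionalEquality using (_≡_; _≢_; refl; sym; trans; cong; subst; module ≡-Reasoning)
import Level

module _ {A : Set} {P Q : Pred A Level.zero} (P? : Decidable P) (Q? : Decidable Q) where

  filter-length-mono : (∀ x → P x → Q x) → ∀ xs →
    length (filter P? xs) ≤ length (filter Q? xs)
  filter-length-mono P⇒Q xs =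
    length-mono-≤ (⊆-filter-Sublist P? Q? (λ { {x} refl → P⇒Q x }) (⊆-refl {x = xs}))

  filter-length-strict : (∀ x → P x → Q x) → ∀ {y} xs → y ∈ xs → Q y → ¬ P y →
    length (filter P? xs) < length (filter Q? xs)
  filter-length-strict P⇒Q (x ∷ xs) (here refl) qx ¬px with P? x | Q? x
  ... | yes px | _     = ⊥-elim (¬px px)
  ... | no _   | yes _ = s≤s (filter-length-mono P⇒Q xs)
  ... | no _   | no ¬q = ⊥-elim (¬q qx)
  filter-length-strict P⇒Q (x ∷ xs) (there y∈xs) qy ¬py with P? x | Q? x
  ... | yes px | yes _ = s≤s (filter-length-strict P⇒Q xs y∈xs qy ¬py)
  ... | yes px | no ¬q = ⊥-elim (¬q (P⇒Q x px))
  ... | no _   | yes _ = m≤n⇒m≤1+n (filter-length-strict P⇒Q xs y∈xs qy ¬py)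
  ... | no _   | no _  = filter-length-strict P⇒Q xs y∈xs qy ¬py

module _ {n : ℕ} {P Q : Pred (Fin n) Level.zero} (P? : Decidable P) (Q? : Decidable Q) where

  count-mono : (∀ x → P x → Q x) → count P? ≤ count Q?
  count-mono P⇒Q = filter-length-mono P? Q? P⇒Q (allFin n)

  count-strict : (∀ x → P x → Q x) → ∀ y → Q y → ¬ P y → count P? < count Q?
  count-strict P⇒Q y = filter-length-strict P? Q? P⇒Q (allFin n) (∈-allFin y)

count-none : ∀ {n} {P : Pred (Fin n) Level.zero} (P? : Decidable P) →
  (∀ x → ¬ P x) → count P? ≡ 0
count-none {n} P? none = cong length (filter-none P? (universal none (allFin n)))

-- Parity of walks: each edge of a bipartite graph switches sides, so the
-- parity of a walk's length decides whether its ends lie on the same side.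

parity : ℕ → Bool
parity zero    = false
parity (suc k) = not (parity k)

parity-+ : ∀ j k → parity (j + k) ≡ parity j xor parity k
parity-+ zero    k = refl
parity-+ (suc j) k = begin
  not (parity (j + k))         ≡⟨ cong not (parity-+ j k) ⟩
  not (parity j xor parity k)  ≡⟨ not-distribˡ-xor (parity j) (parity k) ⟩
  not (parity j) xor parity k  ∎
  where open ≡-Reasoning

parity-double : ∀ k → parity (2 * k) ≡ false
parity-double k = begin
  parity (k + (k + 0))         ≡⟨ parity-+ k (k + 0) ⟩
  parity k xor parity (k + 0)  ≡⟨ cong (λ j → parity k xor parity j) (+-identityʳ k) ⟩
  parity k xor parity k        ≡⟨ xor-same (parity k) ⟩
  false                        ∎
  where open ≡-Reasoning

side : ∀ {n m} → Vertex n m → Bool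
side (inj₁ _) = false
side (inj₂ _) = true

adj-switches-side : ∀ {n m} {E : Graph n m} {x y : Vertex n m} → Adj E x y → side y ≡ not (side x)
adj-switches-side {x = inj₁ _} {inj₂ _} _ = refl
adj-switches-side {x = inj₂ _} {inj₁ _} _ = refl
adj-switches-side {x = inj₁ _} {inj₁ _} ()
adj-switches-side {x = inj₂ _} {inj₂ _} ()

side-after-edge : ∀ {n m} {E : Graph n m} {x u y : Vertex n m} k → Adj E x u →
  side y ≡ parity k xor side u → side y ≡ not (parity k) xor side x
side-after-edge {x = x} {u} {y} k adj walk = begin
  side y                     ≡⟨ walk ⟩
  parity k xor side u        ≡⟨ cong (parity k xor_) (adj-switches-side adj) ⟩
  parity k xor not (side x)  ≡⟨ sym (not-distribʳ-xor (parity k) (side x)) ⟩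
  not (parity k xor side x)  ≡⟨ not-distribˡ-xor (parity k) (side x) ⟩
  not (parity k) xor side x  ∎
  where open ≡-Reasoning

walk-side : ∀ {n m} {E : Graph n m} {M : Assignment n m} {b x y len} →
  AltWalk E M b x y len → side y ≡ parity len xor side x
walk-side stop                      = refl
walk-side (nonM {k = k} adj _ rest) = side-after-edge k adj (walk-side rest)
walk-side (viaM {k = k} adj _ rest) = side-after-edge k adj (walk-side rest)

no-even-walk-applicant-to-post : ∀ {n m} {E : Graph n m} {M : Assignment n m} {b a v} k →
  ¬ AltWalk E M b (inj₁ a) (inj₂ v) (2 * k)
no-even-walk-applicant-to-post k w with trans (walk-side w) (cong (_xor false) (parity-double k))
... | ()

no-odd-walk-post-to-post : ∀ {n m} {E : Graph n m} {M : Assignment n m} {b u v} k →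
  ¬ AltWalk E M b (inj₂ u) (inj₂ v) (suc (2 * k))
no-odd-walk-post-to-post k w with trans (walk-side w) (cong (λ t → not t xor true) (parity-double k))
... | ()

Covers : ∀ {n m} → Assignment n m → Assignment n m → Set
Covers {n} M N = ∀ (b : Fin n) → ¬ M b ≡ nothing → ¬ N b ≡ nothing

PostFree : ∀ {n m} → Assignment n m → Fin m → Set
PostFree {n} M p = ∀ (b : Fin n) → M b ≢ just p

matching-mono : ∀ {n m} {E E′ : Graph n m} {N : Assignment n m} →
  (∀ a p → E a p → E′ a p) → IsMatching E N → IsMatching E′ N
matching-mono E⊆E′ (along , injective) = (λ a p eq → E⊆E′ a p (along a p eq)) , injective

just≢nothing : ∀ {A : Set} {x : A} → just x ≢ nothing
just≢nothing ()

assign : ∀ {n m} → Assignment n m → Fin n → Fin m → Assignment n m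
assign N a p b with b ≟F a
... | yes _ = just p
... | no _  = N b

assign-self : ∀ {n m} (N : Assignment n m) a p → assign N a p a ≡ just p
assign-self N a p with a ≟F a
... | yes _ = refl
... | no a≢a = ⊥-elim (a≢a refl)

assign-view : ∀ {n m} (N : Assignment n m) a p b →
  (b ≡ a × assign N a p b ≡ just p) ⊎ (b ≢ a × assign N a p b ≡ N b)
assign-view N a p b with b ≟F a
... | yes b≡a = inj₁ (b≡a , refl)
... | no b≢a  = inj₂ (b≢a , refl)

assign-matching : ∀ {n m} {E : Graph n m} {N : Assignment n m} {a p} →
  IsMatching E N → E a p → PostFree N p → IsMatching E (assign N a p)
assign-matching {E = E} {N} {a} {p} (along , injective) edge free = along′ , injective′
  where
  along′ : ∀ b q → assign N a p b ≡ just q → E b q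
  along′ b q eq with assign-view N a p b
  ... | inj₁ (refl , v) = subst (E b) (just-injective (trans (sym v) eq)) edge
  ... | inj₂ (_ , v)    = along b q (trans (sym v) eq)
  injective′ : ∀ b c q → assign N a p b ≡ just q → assign N a p c ≡ just q → b ≡ c
  injective′ b c q eb ec with assign-view N a p b | assign-view N a p c
  ... | inj₁ (refl , _)  | inj₁ (refl , _)  = refl
  ... | inj₁ (refl , vb) | inj₂ (_ , vc)    =
    ⊥-elim (free c (trans (trans (sym vc) ec) (sym (trans (sym vb) eb))))
  ... | inj₂ (_ , vb)    | inj₁ (refl , vc) =
    ⊥-elim (free b (trans (trans (sym vb) eb) (sym (trans (sym vc) ec))))
  ... | inj₂ (_ , vb)    | inj₂ (_ , vc)    = injective b c q (trans (sym vb) eb) (trans (sym vc) ec)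

assign-covers : ∀ {n m} (N : Assignment n m) a p → Covers N (assign N a p)
assign-covers N a p b matched with assign-view N a p b
... | inj₁ (_ , v) = λ e → just≢nothing (trans (sym v) e)
... | inj₂ (_ , v) = λ e → matched (trans (sym v) e)

assign-grows : ∀ {n m} {M N : Assignment n m} {a p} → Covers M N → M a ≡ nothing →
  size M < size (assign N a p)
assign-grows {N = N} {a} {p} covers unmatched =
  count-strict _ _ (λ b matched → assign-covers N a p b (covers b matched)) a
    (λ e → just≢nothing (trans (sym (assign-self N a p)) e)) (λ matched → matched unmatched)

-- Chains need not be simple.

data Chain {n m} (E : Graph n m) (M : Assignment n m) (u : Fin m) : Fin m → Set where
  start : Chain E M u u
  step  : ∀ {p a p′} → Chain E M u p → E a p → M a ≡ just p′ → Chain E M u p′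

OnChain : ∀ {n m} {E : Graph n m} {M : Assignment n m} {u p : Fin m} → Chain E M u p → Fin m → Set
OnChain {u = u} start v             = v ≡ u
OnChain (step {p′ = p′} chain _ _) v = v ≡ p′ ⊎ OnChain chain v

on-chain? : ∀ {n m} {E : Graph n m} {M : Assignment n m} {u p : Fin m}
  (chain : Chain E M u p) (v : Fin m) → Dec (OnChain chain v)
on-chain? start v = v ≟F _
on-chain? (step {p′ = p′} chain _ _) v with v ≟F p′ | on-chain? chain v
... | yes v≡p′ | _        = yes (inj₁ v≡p′)
... | no _     | yes on   = yes (inj₂ on)
... | no v≢p′  | no off   = no λ { (inj₁ v≡p′) → v≢p′ v≡p′ ; (inj₂ on) → off on }

end-on-chain : ∀ {n m} {E : Graph n m} {M : Assignment n m} {u p : Fin m}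
  (chain : Chain E M u p) → OnChain chain p
end-on-chain start          = refl
end-on-chain (step _ _ _)   = inj₁ refl

chain-forward : ∀ {n m} {E : Graph n m} {M : Assignment n m} {u p v : Fin m} {len} →
  Chain E M u p → AltWalk E M false (inj₂ p) (inj₂ v) len → Chain E M u v
chain-forward chain stop = chain
chain-forward chain (nonM {u = inj₁ _} edge _ (viaM {u = inj₂ _} _ inM rest)) =
  chain-forward (step chain edge inM) rest
chain-forward chain (nonM {u = inj₁ _} _ _ (viaM {u = inj₁ _} () _ _))
chain-forward chain (nonM {u = inj₂ _} () _ _)

chain-backward : ∀ {n m} {E : Graph n m} {M : Assignment n m} {p q : Fin m} {len} →
  AltWalk E M true (inj₂ p) (inj₂ q) len → Chain E M q p
chain-backward stop = start
chain-backward (viaM {u = inj₁ _} _ inM (nonM {u = inj₂ _} edge _ rest)) =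
  step (chain-backward rest) edge inM
chain-backward (viaM {u = inj₁ _} _ _ (nonM {u = inj₁ _} () _ _))
chain-backward (viaM {u = inj₂ _} () _ _)

record Shift {n m} (E : Graph n m) (M : Assignment n m) {u p : Fin m}
             (chain : Chain E M u p) (v : Fin m) : Set where
  field
    result     : Assignment n m
    isMatching : IsMatching E result
    covers     : Covers M result
    frees      : PostFree result v
    keeps      : ∀ q → ¬ OnChain chain q → ∀ b → M b ≡ just q → result b ≡ just q

shift-extend : ∀ {n m} {E : Graph n m} {M : Assignment n m} {u p p′ : Fin m} {a : Fin n}
  {chain : Chain E M u p} {edge : E a p} {matched : M a ≡ just p′} {v} →
  Shift E M chain v → Shift E M (step chain edge matched) v
shift-extend s = record
  { result = result ; isMatching = isMatching ; covers = covers ; frees = frees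
  ; keeps  = λ q off → keeps q (λ on → off (inj₂ on)) }
  where open Shift s

shift : ∀ {n m} {E : Graph n m} {M : Assignment n m} {u p : Fin m} → IsMatching E M →
  PostFree M u → (chain : Chain E M u p) → ∀ v → OnChain chain v → Shift E M chain v
shift {M = M} isM free start v refl = record
  { result = M ; isMatching = isM ; covers = λ _ matched → matched ; frees = free
  ; keeps = λ _ _ _ eq → eq }
shift isM free (step chain _ _) v (inj₂ on) = shift-extend (shift isM free chain v on)
shift {M = M} isM free (step {p = p} {a} {p′} chain edge matched) .p′ (inj₁ refl)
  with on-chain? chain p′
... | yes on = shift-extend (shift isM free chain p′ on)
... | no off = record
  { result = assign N a p ; isMatching = assign-matching isMatching edge frees
  ; covers = λ b matchedᴹ → assign-covers N a p b (covers b matchedᴹ)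
  ; frees = frees′ ; keeps = keeps′ }
  where
  open Shift (shift isM free chain p (end-on-chain chain)) renaming (result to N)
  -- a keeps its post p′, which lies off the chain, until it is reassigned
  a↦p′ : N a ≡ just p′
  a↦p′ = keeps p′ off a matched
  frees′ : PostFree (assign N a p) p′
  frees′ b eq with assign-view N a p b
  ... | inj₁ (refl , v) = off (subst (OnChain chain) (just-injective (trans (sym v) eq)) (end-on-chain chain))
  ... | inj₂ (b≢a , v) = b≢a (proj₂ isMatching b a p′ (trans (sym v) eq) a↦p′)
  keeps′ : ∀ q → ¬ OnChain (step chain edge matched) q → ∀ b → M b ≡ just q → assign N a p b ≡ just q
  keeps′ q off b eq with assign-view N a p b
  ... | inj₁ (refl , _) = ⊥-elim (off (inj₁ (just-injective (trans (sym eq) matched))))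
  ... | inj₂ (_ , v)    = trans v (keeps q (λ on → off (inj₂ on)) b eq)

even-post-can-be-freed : ∀ {n m} {E : Graph n m} {M : Assignment n m} {v : Fin m} →
  IsMatching E M → IsEven E M (inj₂ v) →
  ∃[ N ] (IsMatching E N × Covers M N × PostFree N v)
even-post-can-be-freed _ (inj₁ _ , k , _ , walk) = ⊥-elim (no-even-walk-applicant-to-post k walk)
even-post-can-be-freed {E = E} {M} {v} isM (inj₂ u , k , free , walk) =
  result , isMatching , covers , frees
  where
  chain : Chain E M u v
  chain = chain-forward start walk
  open Shift (shift isM free chain _ (end-on-chain chain))

-- a free post of a maximum matching is not odd: an odd walk to it from a
-- free applicant b would, after shifting, let b be matched as well
free-post-not-odd : ∀ {n m} {E : Graph n m} {M : Assignment n m} {q : Fin m} →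
  IsMaximumMatching E M → PostFree M q → ¬ IsOdd E M (inj₂ q)
free-post-not-odd _ _ (inj₂ _ , k , _ , walk) = no-odd-walk-post-to-post k walk
free-post-not-odd _ _ (inj₁ _ , _ , _ , nonM {u = inj₁ _} () _ _)
free-post-not-odd {E = E} {M} {q} (isM , maximum) free (inj₁ b , _ , b-free , nonM {u = inj₂ p} edge _ rest) =
  <⇒≱ (assign-grows covers b-free) (maximum _ (assign-matching isMatching edge frees))
  where
  chain : Chain E M q p
  chain = chain-backward rest
  open Shift (shift isM free chain p (end-on-chain chain))

free-post-not-f : ∀ {n m} {E : Graph n m} {M : Assignment n m} {q : Fin m} →
  IsMaximumMatching E M → PostFree M q →
  ¬ (IsOdd E M (inj₂ q) ⊎ IsUnreachable E M (inj₂ q))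
free-post-not-f max free (inj₁ odd)         = free-post-not-odd max free odd
free-post-not-f _   free (inj₂ (not-even , _)) = not-even (inj₂ _ , 0 , free , stop)

matchRank-edge : ∀ {n m} (X : Instance n m) (M : Assignment n m) a {r} →
  matchRank X M a ≡ just r → ∃[ p ] (M a ≡ just p × X a p ≡ just r)
matchRank-edge X M a eq with M a
... | just p  = p , refl , eq
... | nothing with eq
...   | ()

matchRank-at : ∀ {n m} (X : Instance n m) (M : Assignment n m) a {p} →
  M a ≡ just p → matchRank X M a ≡ X a p
matchRank-at X M a eq with M a
matchRank-at X M a refl | just p = refl

no-rank-zero : ∀ {n m} {X : Instance n m} → PositiveRanks X → ∀ M → signature X M 0 ≡ 0
no-rank-zero {X = X} positive M = count-none _ rank-not-zero
  where
  rank-not-zero : ∀ a → ¬ matchRank X M a ≡ just 0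
  rank-not-zero a eq with matchRank-edge X M a eq
  ... | p , _ , X≡0 with positive a p 0 X≡0
  ...   | ()

rank-one-optimal : ∀ {n m} {X : Instance n m} {M N : Assignment n m} → PositiveRanks X →
  IsRankMaximal X M → IsMatching (edges X) N → signature X N 1 ≤ signature X M 1
rank-one-optimal {X = X} {M} {N} positive (_ , maximal) isN
  with signature X N 1 ≤ℕ? signature X M 1
... | yes N≤M = N≤M
... | no N≰M  = ⊥-elim (maximal N isN (1 , ≰⇒> N≰M , agree-below-1))
  where
  agree-below-1 : ∀ j → j < 1 → signature X M j ≡ signature X N j
  agree-below-1 zero    _        = trans (no-rank-zero positive M) (sym (no-rank-zero positive N))
  agree-below-1 (suc j) (s≤s ())

RankOne : ∀ {n m} → Instance n m → Graph n m
RankOne X a p = X a p ≡ just 1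

rank-one-edges : ∀ {n m} {X : Instance n m} a p → RankOne X a p → edges X a p
rank-one-edges a p rank-one = 1 , rank-one

rank-one-size : ∀ {n m} {X : Instance n m} {N : Assignment n m} →
  IsMatching (RankOne X) N → size N ≤ signature X N 1
rank-one-size {X = X} {N} (along , _) = count-mono _ _ matched-at-rank-one
  where
  matched-at-rank-one : ∀ a → ¬ N a ≡ nothing → matchRank X N a ≡ just 1
  matched-at-rank-one a matched with N a in eq
  ... | nothing = ⊥-elim (matched refl)
  ... | just p  = along a p eq

restrict : ∀ {n m} → Instance n m → Fin n → Assignment n m → Assignment n m
restrict G a₁ M a with a ≟F a₁ | M a
... | yes _ | _       = nothing
... | no _  | nothing = nothing
... | no _  | just p with ≡-dec _≟ℕ_ (G a p) (just 1)
...   | yes _ = just p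
...   | no _  = nothing

restrict-sound : ∀ {n m} (G : Instance n m) a₁ (M : Assignment n m) a {p} →
  restrict G a₁ M a ≡ just p → a ≢ a₁ × M a ≡ just p × G a p ≡ just 1
restrict-sound G a₁ M a eq with a ≟F a₁ | M a
restrict-sound G a₁ M a () | yes _ | _
restrict-sound G a₁ M a () | no _  | nothing
restrict-sound G a₁ M a eq | no a≢a₁ | just q with ≡-dec _≟ℕ_ (G a q) (just 1)
restrict-sound G a₁ M a refl | no a≢a₁ | just q | yes rank-one = a≢a₁ , refl , rank-one
restrict-sound G a₁ M a ()   | no a≢a₁ | just q | no _

restrict-complete : ∀ {n m} (G : Instance n m) a₁ (M : Assignment n m) a {p} → a ≢ a₁ →
  M a ≡ just p → G a p ≡ just 1 → restrict G a₁ M a ≡ just p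
restrict-complete G a₁ M a a≢a₁ eq rank-one with a ≟F a₁ | M a
... | yes a≡a₁ | _ = ⊥-elim (a≢a₁ a≡a₁)
restrict-complete G a₁ M a a≢a₁ () rank-one | no _ | nothing
restrict-complete G a₁ M a a≢a₁ refl rank-one | no _ | just q with ≡-dec _≟ℕ_ (G a q) (just 1)
... | yes _   = refl
... | no rank≢1 = ⊥-elim (rank≢1 rank-one)

restrict-matching : ∀ {n m} {E : Graph n m} (G : Instance n m) a₁ {M : Assignment n m} →
  IsMatching E M → IsMatching (G1minus G a₁) (restrict G a₁ M)
restrict-matching G a₁ {M} (_ , injective) = along , injective′
  where
  along : ∀ a p → restrict G a₁ M a ≡ just p → G1minus G a₁ a p
  along a p eq = let (a≢a₁ , _ , rank-one) = restrict-sound G a₁ M a eq in a≢a₁ , rank-one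
  injective′ : ∀ a b p → restrict G a₁ M a ≡ just p → restrict G a₁ M b ≡ just p → a ≡ b
  injective′ a b p ea eb =
    injective a b p (proj₁ (proj₂ (restrict-sound G a₁ M a ea))) (proj₁ (proj₂ (restrict-sound G a₁ M b eb)))

restrict-frees : ∀ {n m} {E : Graph n m} (G : Instance n m) {a₁} {M : Assignment n m} {q} →
  IsMatching E M → M a₁ ≡ just q → PostFree (restrict G a₁ M) q
restrict-frees G {a₁} {M} (_ , injective) M↦q b eq =
  let (b≢a₁ , M↦q′ , _) = restrict-sound G a₁ M b eq in b≢a₁ (injective b a₁ _ M↦q′ M↦q)

K-avoids : ∀ {n m} (G : Instance n m) a₁ {N : Assignment n m} →
  IsMatching (G1minus G a₁) N → N a₁ ≡ nothing
K-avoids G a₁ {N} (along , _) with N a₁ in eq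
... | nothing = refl
... | just p  = ⊥-elim (proj₁ (along a₁ p eq) refl)

K-rank-one : ∀ {n m} {G X : Instance n m} {a₁} → SameExcept G X a₁ →
  ∀ a p → G1minus G a₁ a p → RankOne X a p
K-rank-one same a p (a≢a₁ , rank-one) = trans (same a a≢a₁ p) rank-one

restrict-bound : ∀ {n m} {G X : Instance n m} {a₁} {M : Assignment n m} → SameExcept G X a₁ →
  ¬ matchRank X M a₁ ≡ just 1 → signature X M 1 ≤ size (restrict G a₁ M)
restrict-bound {G = G} {X} {a₁} {M} same a₁-not-one = count-mono _ _ kept
  where
  kept : ∀ b → matchRank X M b ≡ just 1 → ¬ restrict G a₁ M b ≡ nothing
  kept b rank-one with matchRank-edge X M b rank-one
  ... | p , M↦p , X≡1 = λ eq → just≢nothing (trans (sym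
          (restrict-complete G a₁ M b b≢a₁ M↦p (trans (sym (same b b≢a₁ p)) X≡1))) eq)
    where
    b≢a₁ : b ≢ a₁
    b≢a₁ refl = a₁-not-one rank-one

restriction-maximum : ∀ {n m} {G : Instance n m} {a₁} {M : Assignment n m} → PositiveRanks G →
  IsRankMaximal G M → ¬ matchRank G M a₁ ≡ just 1 → IsMaximumMatching (G1minus G a₁) (restrict G a₁ M)
restriction-maximum {G = G} {a₁} {M} positive rmax a₁-not-one =
  restrict-matching G a₁ (proj₁ rmax) , bound
  where
  open ≤-Reasoning
  same-instance : SameExcept G G a₁
  same-instance _ _ _ = refl
  bound : ∀ N → IsMatching (G1minus G a₁) N → size N ≤ size (restrict G a₁ M)
  bound N isN = begin
    size N                  ≤⟨ rank-one-size isN₁ ⟩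
    signature G N 1         ≤⟨ rank-one-optimal positive rmax (matching-mono rank-one-edges isN₁) ⟩
    signature G M 1         ≤⟨ restrict-bound {G = G} {G} same-instance a₁-not-one ⟩
    size (restrict G a₁ M)  ∎
    where
    isN₁ : IsMatching (RankOne G) N
    isN₁ = matching-mono (K-rank-one {G = G} same-instance) isN

2≰1 : ¬ 2 ≤ 1
2≰1 (s≤s ())

falsified-positive : ∀ {n m} {G H : Instance n m} {a₁ p} → PositiveRanks G →
  SameExcept G H a₁ → FullListTopping H a₁ p → PositiveRanks H
falsified-positive {a₁ = a₁} {p} positive same (_ , _ , top , others) a q r H≡r
  with a ≟F a₁ | q ≟F p
... | no a≢a₁  | _        = positive a q r (trans (sym (same a a≢a₁ q)) H≡r)
... | yes refl | yes refl = subst (1 ≤_) (just-injective (trans (sym top) H≡r)) (s≤s z≤n)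
... | yes refl | no q≢p   = <⇒≤ (others q r q≢p H≡r)

falsified-rank-one : ∀ {n m} {H : Instance n m} {a₁ p} {M : Assignment n m} →
  FullListTopping H a₁ p → matchRank H M a₁ ≡ just 1 → M a₁ ≡ just p
falsified-rank-one {H = H} {a₁} {p} {M} (_ , _ , _ , others) rank-one
  with matchRank-edge H M a₁ rank-one
... | q , M↦q , H≡1 with q ≟F p
...   | yes refl = M↦q
...   | no q≢p   = ⊥-elim (2≰1 (others q 1 q≢p H≡1))

-- Otherwise p is even in K, so it can be freed in a maximum matching
-- of K and then given to a₁, producing more rank one edges than M′ has.
falsified-instance-forces-top : ∀ {n m} {G H : Instance n m} {a₁ p} {M : Assignment n m} →
  PositiveRanks H → SameExcept G H a₁ → FullListTopping H a₁ p →
  IsMaximumMatching (G1minus G a₁) M → ¬ IsFPostWrt G a₁ M p →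
  ∀ M′ → IsRankMaximal H M′ → M′ a₁ ≡ just p
falsified-instance-forces-top {G = G} {H} {a₁} {p} {M} positive same full@(_ , _ , top , _) (isM , maximum) non-f M′ rmax =
  decidable-stable (≡-dec _≟F_ (M′ a₁) (just p)) λ not-top →
    non-f (inj₂ (not-even not-top , λ odd → non-f (inj₁ odd)))
  where
  open ≤-Reasoning
  not-even : ¬ M′ a₁ ≡ just p → ¬ IsEven (G1minus G a₁) M (inj₂ p)
  not-even not-top even with even-post-can-be-freed isM even
  ... | N , isN , covers , frees = <⇒≱ more (rank-one-optimal positive rmax (matching-mono rank-one-edges isN′))
    where
    N′ : Assignment _ _
    N′ = assign N a₁ p
    isN′ : IsMatching (RankOne H) N′
    isN′ = assign-matching (matching-mono (K-rank-one same) isN) top frees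
    more : signature H M′ 1 < signature H N′ 1
    more = begin-strict
      signature H M′ 1         ≤⟨ restrict-bound same (λ one → not-top (falsified-rank-one {M = M′} full one)) ⟩
      size (restrict G a₁ M′)  ≤⟨ maximum _ (restrict-matching G a₁ (proj₁ rmax)) ⟩
      size M                   <⟨ assign-grows covers (K-avoids G a₁ isM) ⟩
      size N′                  ≤⟨ rank-one-size isN′ ⟩
      signature H N′ 1         ∎

-- Part (2): if a rank-maximal matching of G gives a₁ a post q of rank > 1,
-- then q is free in the maximum matching of K obtained by restriction, hence
-- a non-f-post.
nonfirst-post-is-non-f : ∀ {n m} {G : Instance n m} {a₁} {M : Assignment n m} {q r} →
  PositiveRanks G → IsRankMaximal G M → M a₁ ≡ just q → G a₁ q ≡ just r → 2 ≤ r →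
  IsNonFPost G a₁ q
nonfirst-post-is-non-f {G = G} {a₁} {M} {q} positive rmax M↦q G≡r 2≤r =
  restrict G a₁ M , maximum , free-post-not-f maximum (restrict-frees G (proj₁ rmax) M↦q)
  where
  not-rank-one : ¬ matchRank G M a₁ ≡ just 1
  not-rank-one one =
    2≰1 (subst (2 ≤_) (just-injective (trans (sym G≡r) (trans (sym (matchRank-at G M a₁ M↦q)) one))) 2≤r)
  maximum : IsMaximumMatching (G1minus G a₁) (restrict G a₁ M)
  maximum = restriction-maximum positive rmax not-rank-one

theorem1 : ∀ {n m} (G H : Instance n m) (a₁ : Fin n) (pᵢ : Fin m) (rᵢ : ℕ) →
    PositiveRanks G →
    (∃[ M ] (IsRankMaximal G M × ¬ (matchRank G M a₁ ≡ just 1))) →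
    (∃[ p ] ∃[ r ] (G a₁ p ≡ just r × IsNonFPost G a₁ p)) →
    G a₁ pᵢ ≡ just rᵢ → IsNonFPost G a₁ pᵢ →
    (∀ (q : Fin m) (r : ℕ) → G a₁ q ≡ just r → IsNonFPost G a₁ q → rᵢ ≤ r) →
    SameExcept G H a₁ →
    FullListTopping H a₁ pᵢ →
    (∀ M′ → IsRankMaximal H M′ → M′ a₁ ≡ just pᵢ) ×
    (∀ M′ → IsRankMaximal G M′ → ∀ (q : Fin m) (r : ℕ) →
       M′ a₁ ≡ just q → G a₁ q ≡ just r → 2 ≤ r → rᵢ ≤ r)
theorem1 G H a₁ pᵢ rᵢ positive _ _ _ (M , maximum , non-f) best same full =
  falsified-instance-forces-top (falsified-positive positive same full) same full maximum non-f ,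
  λ M′ rmax q r M′↦q G≡r 2≤r → best q r G≡r (nonfirst-post-is-non-f positive rmax M′↦q G≡r 2≤r)
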